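{- Let $V$ be a valuation algebra, $x$ a formula and $H\in V$. (a) If $V$ is repetition-proof, then $x\diamond H$ is a repetition-proof valuation path. (b) If $V$ is memorizing, then $x\diamond H$ is a memorizing valuation path.
   Context: Fix a set $\mathcal{A}$ of atoms. Formulas: $x ::= \mathrm{T} \mid a \mid \neg x \mid x \mathbin{\triangleleft\wedge} x$ ($a\in\mathcal{A}$). A valuation algebra is a nonempty set $V$ with maps $/:\mathcal{A}\times V\to\{\mathrm{T},\mathrm{F}\}$ and $\bullet:\mathcal{A}\times V\to V$, extended to formulas by: $\mathrm{T}/H=\mathrm{T}$, $\mathrm{T}\bullet H=H$; $(\neg x)/H=\neg(x/H)$, $(\neg x)\bullet H=x\bullet H$; $(x\mathbin{\triangleleft\wedge}y)/H = y/(x\bullet H)$ if $x/H=\mathrm{T}$, else $\mathrm{F}$; $(x\mathbin{\triangleleft\wedge}y)\bullet H = y\bullet(x\bullet H)$ if $x/H=\mathrm{T}$, else $x\bullet H$. ($u\bullet v\bullet H$ means $u\bullet(v\bullet H)$.) $V$ is repetition-proof if $a/(a\bullet H)=a/H$ for all $a\in\mathcal{A},H\in V$; memorizing if it is repetition-proof, $a\bullet a\bullet H=a\bullet H$, $a/(b\bullet a\bullet H)=a/H$ and $a\bullet b\bullet a\bullet H=b\bullet a\bullet H$ for all $a,b\in\mathcal{A},H\in V$. A valuation path is a finite sequence $\langle(u_1,b_1),\dots,(u_n,b_n)\rangle$ in $\mathcal{A}\times\{\mathrm{T},\mathrm{F}\}$; $\epsilon$ empty, $\cdot$ concatenation. It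 is repetition-proof if $u_i=u_{i+1}\Rightarrow b_i=b_{i+1}$ for all $i<n$, memorizing if $u_i=u_j\Rightarrow b_i=b_j$ for all $i,j\le n$. Evaluation path: $\mathrm{T}\diamond H=\epsilon$; $a\diamond H=\langle(a,a/H)\rangle$; $(\neg x)\diamond H=x\diamond H$; $(x\mathbin{\triangleleft\wedge}y)\diamond H=(x\diamond H)\cdot(y\diamond(x\bullet H))$ if $x/H=\mathrm{T}$, and $x\diamond H$ otherwise. -}

module Defs where

open import Level using (Level; _⊔_; suc)
open import Data.Bool using (Bool; true; false; not)
open import Data.Product using (_×_; _,_)
open import Data.List using (List; []; _∷_; _++_; [_])
open import Data.List.Relation.Unary.Linked using (Linked)
open import Data.List.Relation.Unary.AllPairs using (AllPairs)
open import Relation.Binary.PropositionalEquality using (_≡_)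

-- Truth values T, F are represented by Bool (true = T, false = F).

data Formula {a : Level} (A : Set a) : Set a where
  tt   : Formula A
  atom : A → Formula A
  neg  : Formula A → Formula A
  _◁∧_ : Formula A → Formula A → Formula A

record ValuationAlgebra {a} (A : Set a) (v : Level) : Set (a ⊔ suc v) where
  field
    V      : Set v
    inhab  : V                 -- nonemptiness
    _/ₐ_   : A → V → Bool
    _•ₐ_   : A → V → V

module _ {a v} {A : Set a} (VA : ValuationAlgebra A v) where
  open ValuationAlgebra VA

  mutual
    _/_ : Formula A → V → Bool
    tt / H = true
    atom p / H = p /ₐ H
    neg x / H = not (x / H)
    (x ◁∧ y) / H with x / H
    ... | true  = y / (x • H)
    ... | false = false

    _•_ : Formula A → V → V
    tt • H = H
    atom p • H = p •ₐ H
    neg x • H = x • H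
    (x ◁∧ y) • H with x / H
    ... | true  = y • (x • H)
    ... | false = x • H

  _◇_ : Formula A → V → List (A × Bool)
  tt ◇ H = []
  atom p ◇ H = [ (p , p /ₐ H) ]
  neg x ◇ H = x ◇ H
  (x ◁∧ y) ◇ H with x / H
  ... | true  = (x ◇ H) ++ (y ◇ (x • H))
  ... | false = x ◇ H

  IsRepetitionProofAlg : Set _
  IsRepetitionProofAlg = ∀ (p : A) (H : V) → p /ₐ (p •ₐ H) ≡ p /ₐ H

  IsMemorizingAlg : Set _
  IsMemorizingAlg =
    IsRepetitionProofAlg ×
    (∀ (p : A) (H : V) → p •ₐ (p •ₐ H) ≡ p •ₐ H) ×
    (∀ (p q : A) (H : V) → p /ₐ (q •ₐ (p •ₐ H)) ≡ p /ₐ H) ×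
    (∀ (p q : A) (H : V) → p •ₐ (q •ₐ (p •ₐ H)) ≡ q •ₐ (p •ₐ H))

RPRel : ∀ {a} {A : Set a} → (A × Bool) → (A × Bool) → Set a
RPRel (u , b) (u' , b') = u ≡ u' → b ≡ b'

IsRepetitionProofPath : ∀ {a} {A : Set a} → List (A × Bool) → Set a
IsRepetitionProofPath = Linked RPRel

-- memorizing: any two entries (i < j; i = j is trivial, and the relation
-- is symmetric) with equal atoms have equal values
IsMemorizingPath : ∀ {a} {A : Set a} → List (A × Bool) → Set a
IsMemorizingPath = AllPairs RPRel

module Submission where

-- The evaluation path x ◇ H is built by recursion on x, and a
-- conjunction concatenates two subpaths, so neither property can be proved
-- by a direct induction on x.  Instead we generalise over an arbitrary
-- tail that follows the path: if a tail is well behaved relative to the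
-- state x • H reached after evaluating x, then (x ◇ H) ++ tail is well
-- behaved relative to the starting state H.  The theorem is the instance
-- with the empty tail.
--
-- (a) "Well behaved relative to G" means: the tail is repetition-proof and
--     its first entry (if any) records the value its atom has in state G.
--     Repetition-proofness of V is exactly what makes an atom evaluated in
--     H link correctly to an entry read off in the state reached after it.
-- (b) "Well behaved relative to G" means: the tail is memorizing and agrees
--     with every atom value that G remembers (p • G = G and p / G = b).
--     The memorizing axioms show that what a state remembers persists along
--     all further evaluation, so every later entry respects it.

open import Defs
open import Level using (Level; _⊔_)
open import Data.Product using (_×_; _,_)
open import Data.Bool using (Bool; true; false)
open import Data.Unit using (⊤)
open import Data.List using (List; []; _∷_; _++_)
open import Data.List.Properties using (++-assoc; ++-identityʳ)
open import Data.List.Relation.Unary.Linked using ([]; [-]; _∷_)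
open import Data.List.Relation.Unary.AllPairs using ([]; _∷_)
open import Data.List.Relation.Unary.All using (All; []; _∷_)
open import Relation.Binary.PropositionalEquality using (_≡_; refl; sym; trans; cong; subst)

module EvaluationPaths {a v} {A : Set a} (VA : ValuationAlgebra A v) where
  open ValuationAlgebra VA

  Path : Set a
  Path = List (A × Bool)

  _/ᶠ_ : Formula A → V → Bool
  _/ᶠ_ = _/_ VA

  _•ᶠ_ : Formula A → V → V
  _•ᶠ_ = _•_ VA

  _◇ᶠ_ : Formula A → V → Path
  _◇ᶠ_ = _◇_ VA

  StartsIn : V → Path → Set
  StartsIn G []            = ⊤
  StartsIn G ((q , b) ∷ _) = b ≡ q /ₐ G

  RPTail : V → Path → Set a
  RPTail G l = IsRepetitionProofPath l × StartsIn G l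

  module RepetitionProof (rp : IsRepetitionProofAlg VA) where

    -- Evaluating atom p in H and then reading the next entry in p • H
    -- respects repetition-proofness: if that entry is again about p, its
    -- value is p / (p • H) = p / H.
    atom-then-tail : ∀ p H l → RPTail (p •ₐ H) l →
                     IsRepetitionProofPath ((p , p /ₐ H) ∷ l)
    atom-then-tail p H []            _              = [-]
    atom-then-tail p H ((q , b) ∷ l) (linked , b≡) = sameValue ∷ linked
      where
      sameValue : RPRel (p , p /ₐ H) (q , b)
      sameValue refl = sym (trans b≡ (rp p H))

    path-then-tail : ∀ x H l → RPTail (x •ᶠ H) l → RPTail H ((x ◇ᶠ H) ++ l)
    path-then-tail tt       H l ok = ok
    path-then-tail (atom q) H l ok = atom-then-tail q H l ok , refl
    path-then-tail (neg x)  H l ok = path-then-tail x H l ok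
    path-then-tail (x ◁∧ y) H l ok with x /ᶠ H
    ... | true rewrite ++-assoc (x ◇ᶠ H) (y ◇ᶠ (x •ᶠ H)) l =
          path-then-tail x H _ (path-then-tail y (x •ᶠ H) l ok)
    ... | false = path-then-tail x H l ok

    path-repetition-proof : ∀ x H → IsRepetitionProofPath (x ◇ᶠ H)
    path-repetition-proof x H with path-then-tail x H [] ([] , _)
    ... | linked , _ = subst IsRepetitionProofPath (++-identityʳ (x ◇ᶠ H)) linked

  Remembers : V → A → Bool → Set v
  Remembers G p b = (p •ₐ G ≡ G) × (p /ₐ G ≡ b)

  module Persistence
    (read-past : ∀ (p q : A) (H : V) → p /ₐ (q •ₐ (p •ₐ H)) ≡ p /ₐ H)
    (step-past : ∀ (p q : A) (H : V) → p •ₐ (q •ₐ (p •ₐ H)) ≡ q •ₐ (p •ₐ H))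
    where

    remembers-atom : ∀ {G p b} q → Remembers G p b → Remembers (q •ₐ G) p b
    remembers-atom {G} {p} q (fixed , value) =
      trans (cong (λ K → p •ₐ (q •ₐ K)) (sym fixed))
            (trans (step-past p q G) (cong (q •ₐ_) fixed)) ,
      trans (cong (λ K → p /ₐ (q •ₐ K)) (sym fixed))
            (trans (read-past p q G) value)

    remembers-formula : ∀ {G p b} x → Remembers G p b → Remembers (x •ᶠ G) p b
    remembers-formula         tt       r = r
    remembers-formula         (atom q) r = remembers-atom q r
    remembers-formula         (neg x)  r = remembers-formula x r
    remembers-formula {G = G} (x ◁∧ y) r with x /ᶠ G
    ... | true  = remembers-formula y (remembers-formula x r)
    ... | false = remembers-formula x r

  MemTail : V → Path → Set (a ⊔ v)
  MemTail G l = IsMemorizingPath l × (∀ p b → Remembers G p b → All (RPRel (p , b)) l)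

  module Memorizing
    (rp        : IsRepetitionProofAlg VA)
    (idem      : ∀ (p : A) (H : V) → p •ₐ (p •ₐ H) ≡ p •ₐ H)
    (read-past : ∀ (p q : A) (H : V) → p /ₐ (q •ₐ (p •ₐ H)) ≡ p /ₐ H)
    (step-past : ∀ (p q : A) (H : V) → p •ₐ (q •ₐ (p •ₐ H)) ≡ q •ₐ (p •ₐ H))
    where
    open Persistence read-past step-past

    remembers-evaluated : ∀ p H → Remembers (p •ₐ H) p (p /ₐ H)
    remembers-evaluated p H = idem p H , rp p H

    path-then-tail : ∀ x H l → MemTail (x •ᶠ H) l → MemTail H ((x ◇ᶠ H) ++ l)
    path-then-tail tt       H l ok = ok
    path-then-tail (atom q) H l (allPairs , agrees) =
      agrees q (q /ₐ H) (remembers-evaluated q H) ∷ allPairs ,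
      λ p b r → agreesHere p b r ∷ agrees p b (remembers-atom q r)
      where
      agreesHere : ∀ p b → Remembers H p b → RPRel (p , b) (q , q /ₐ H)
      agreesHere p b (_ , value) refl = sym value
    path-then-tail (neg x)  H l ok = path-then-tail x H l ok
    path-then-tail (x ◁∧ y) H l ok with x /ᶠ H
    ... | true rewrite ++-assoc (x ◇ᶠ H) (y ◇ᶠ (x •ᶠ H)) l =
          path-then-tail x H _ (path-then-tail y (x •ᶠ H) l ok)
    ... | false = path-then-tail x H l ok

    path-memorizing : ∀ x H → IsMemorizingPath (x ◇ᶠ H)
    path-memorizing x H with path-then-tail x H [] ([] , λ _ _ _ → [])
    ... | allPairs , _ = subst IsMemorizingPath (++-identityʳ (x ◇ᶠ H)) allPairs

proposition4p17 : ∀ {a v : Level} {A : Set a} (VA : ValuationAlgebra A v)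
                  (x : Formula A) (H : ValuationAlgebra.V VA) →
                  (IsRepetitionProofAlg VA → IsRepetitionProofPath (_◇_ VA x H)) ×
                  (IsMemorizingAlg VA → IsMemorizingPath (_◇_ VA x H))
proposition4p17 VA x H =
  (λ rp  → RepetitionProof.path-repetition-proof rp x H) ,
  (λ { (rp , idem , read-past , step-past) →
          Memorizing.path-memorizing rp idem read-past step-past x H })
  where open EvaluationPaths VA
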